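{- Let $R$ be a state transition relation on the set $Q$ of states of a $9\times 9$ Sudoku grid, and let $q_0=(f_0,g_0),\dots,q_k=(f_k,g_k)$ be states with $q_s\,R\,q_{s+1}$ for all $s\in\{0,\dots,k-1\}$. If $g_s\neq g_{s+1}$ for all $s\in\{0,\dots,k-1\}$, then $k\le 648$.
   Context: Cells are pairs $(i,j)$ with $0\le i,j\le 8$; a group is a row, a column, or one of the nine $3\times 3$ blocks. A state of grid is a pair $(f,g)$ where $f$ maps each cell to $\{0,1,\dots,9\}$ ($f(i,j)=n\neq0$ means $n$ is placed at $(i,j)$, $0$ means empty) and $g$ maps each cell to a subset of $\{1,\dots,9\}$ (the candidates), such that for all cells $(i,j)$ and $n\in\{1,\dots,9\}$: (S1) $g(i,j)\neq\emptyset$; (S2) $n\notin g(i,j)$ whenever there is a nonzero $n'\neq n$ with $f(i,j)=n'$, or there is a cell $(i',j')\neq(i,j)$ in a common group with $(i,j)$ with $f(i',j')=n$. $Q$ denotes the set of all states. A state transition relation is a binary relation $R\subseteq Q\times Q$ such that: whenever $(f,g)\,R\,(f',g')$, for every cell $(i,j)$ and nonzero digit $n$, $f(i,j)=n$ implies $f'(i,j)=n$, and $n\notin g(i,j)$ implies $n\notin g'(i,j)$; and for any states $q_1=(f_1,g_1),q_2=(f_2,g_2),q_3$ with $q_1Rq_2$ and $q_2Rq_3$, if $g_1=g_2$ then $q_2=q_3$. -}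

module Defs where

open import Data.Nat using (ℕ; _/_)
open import Data.Fin using (Fin; zero; suc; toℕ)
open import Data.Fin.Subset using (Subset; ⊥; _∈_; _∉_)
open import Data.Product using (_×_; ∃; ∃-syntax; Σ)
open import Data.Sum using (_⊎_)
open import Relation.Binary.PropositionalEquality using (_≡_; _≢_)
open import Relation.Nullary using (¬_)

Cell : Set
Cell = Fin 9 × Fin 9

-- Cell contents: Fin 10, value 0 = empty, value (suc d) = digit d+1.
-- A nonzero digit n ∈ {1..9} is represented by d : Fin 9 with n = d + 1,
-- i.e. "f(i,j) = n" is  f i j ≡ suc d.
-- Candidate sets: subsets of {1..9}, as Subset 9 (d ∈ g i j  iff  digit d+1 is a candidate).

CommonGroup : Fin 9 → Fin 9 → Fin 9 → Fin 9 → Set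
CommonGroup i j i' j' =
  (i ≡ i') ⊎ ((j ≡ j') ⊎ ((toℕ i / 3 ≡ toℕ i' / 3) × (toℕ j / 3 ≡ toℕ j' / 3)))

DistinctCell : Fin 9 → Fin 9 → Fin 9 → Fin 9 → Set
DistinctCell i j i' j' = ¬ ((i ≡ i') × (j ≡ j'))

record State : Set where
  field
    f  : Fin 9 → Fin 9 → Fin 10
    g  : Fin 9 → Fin 9 → Subset 9
    S1 : ∀ i j → ¬ (g i j ≡ ⊥)
    S2 : ∀ i j (d : Fin 9) →
         ((∃[ d' ] ((f i j ≡ suc d') × (d' ≢ d)))
          ⊎ (∃[ i' ] ∃[ j' ] (DistinctCell i j i' j' × CommonGroup i j i' j' × (f i' j' ≡ suc d))))
         → d ∉ g i j
open State public

SameG : State → State → Set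
SameG q q' = ∀ i j → g q i j ≡ g q' i j

SameState : State → State → Set
SameState q q' = ∀ i j → (f q i j ≡ f q' i j) × (g q i j ≡ g q' i j)

record IsStateTransition (R : State → State → Set) : Set₁ where
  field
    keepsPlaced : ∀ {q q'} → R q q' → ∀ i j (d : Fin 9) → f q i j ≡ suc d → f q' i j ≡ suc d
    keepsRemoved : ∀ {q q'} → R q q' → ∀ i j (d : Fin 9) → d ∉ g q i j → d ∉ g q' i j
    stable : ∀ {q₁ q₂ q₃} → R q₁ q₂ → R q₂ q₃ → SameG q₁ q₂ → SameState q₂ q₃

{-# OPTIONS --safe #-}
-- The potential is the total number of candidates.  A transition can only
-- remove candidates, so the count never increases, and if it does not drop
-- then no candidate set changed at all (only this monotonicity of R is needed).
-- Hence every step of the chain lowers the count, which starts at most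
-- 9·81 = 729 and stays at least 81 by (S1): at most 648 steps.

module Submission where

open import Defs
open import Data.Nat using (ℕ; suc; _≤_)
open import Data.Fin using (Fin; inject₁) renaming (suc to fsuc)
open import Relation.Nullary using (¬_)

open import Data.Nat using (zero; _+_; _<_; z≤n; s≤s; s≤s⁻¹)
open import Data.Nat.Properties
  using (+-0-commutativeMonoid; ≤-refl; ≤-reflexive; ≤-trans; ≤-antisym; ≤⇒≯; ≰⇒>;
         +-mono-≤; +-monoʳ-≤; +-cancelʳ-≤; module ≤-Reasoning)
open import Algebra.Properties.CommutativeMonoid.Sum +-0-commutativeMonoid
  using (sum; sum-remove; sum-syntax)
open import Data.Fin using (fromℕ; punchIn) renaming (zero to fzero)
open import Data.Fin.Subset using (Subset; ∣_∣; _⊆_; inside; outside; ⊥)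
open import Data.Fin.Subset.Properties using (_∈?_; drop-∷-⊆; ∣p∣≤n; p⊆q⇒∣p∣≤∣q∣)
open import Data.Vec using ([]; _∷_; here)
open import Relation.Nullary using (contradiction)
open import Function using (_∘_)
open import Relation.Nullary.Decidable using (decidable-stable)
open import Relation.Binary.PropositionalEquality using (_≡_; _≢_; _≗_; refl; cong; sym)

sum-mono-≤ : ∀ {n} {a b : Fin n → ℕ} → (∀ i → a i ≤ b i) → sum a ≤ sum b
sum-mono-≤ {zero}  a≤b = z≤n
sum-mono-≤ {suc n} {a} {b} a≤b =
  +-mono-≤ (a≤b fzero) (sum-mono-≤ {a = a ∘ fsuc} {b ∘ fsuc} (a≤b ∘ fsuc))

sum-≥-squeeze : ∀ {n} {a b : Fin n → ℕ} → (∀ i → a i ≤ b i) → sum b ≤ sum a → a ≗ b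
sum-≥-squeeze {suc n} {a} {b} a≤b Σb≤Σa i = ≤-antisym (a≤b i) (+-cancelʳ-≤ _ (b i) (a i) b≤a)
  where
  open ≤-Reasoning
  b≤a : b i + sum (λ j → b (punchIn i j)) ≤ a i + sum (λ j → b (punchIn i j))
  b≤a = begin
    b i + sum (λ j → b (punchIn i j)) ≡⟨ sym (sum-remove {i = i} b) ⟩
    sum b                             ≤⟨ Σb≤Σa ⟩
    sum a                             ≡⟨ sum-remove {i = i} a ⟩
    a i + sum (λ j → a (punchIn i j)) ≤⟨ +-monoʳ-≤ (a i) (sum-mono-≤ (λ j → a≤b (punchIn i j))) ⟩
    a i + sum (λ j → b (punchIn i j)) ∎

p≢⊥⇒∣p∣>0 : ∀ {n} {p : Subset n} → p ≢ ⊥ → 0 < ∣ p ∣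
p≢⊥⇒∣p∣>0 {p = []}          p≢⊥ = contradiction refl p≢⊥
p≢⊥⇒∣p∣>0 {p = outside ∷ p} p≢⊥ = p≢⊥⇒∣p∣>0 (p≢⊥ ∘ cong (outside ∷_))
p≢⊥⇒∣p∣>0 {p = inside ∷ p}  p≢⊥ = s≤s z≤n

p⊆q∧∣q∣≤∣p∣⇒p≡q : ∀ {n} {p q : Subset n} → p ⊆ q → ∣ q ∣ ≤ ∣ p ∣ → p ≡ q
p⊆q∧∣q∣≤∣p∣⇒p≡q {p = []}          {[]}          _   _ = refl
p⊆q∧∣q∣≤∣p∣⇒p≡q {p = outside ∷ p} {outside ∷ q} p⊆q ∣q∣≤∣p∣ =
  cong (outside ∷_) (p⊆q∧∣q∣≤∣p∣⇒p≡q (drop-∷-⊆ p⊆q) ∣q∣≤∣p∣)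
p⊆q∧∣q∣≤∣p∣⇒p≡q {p = outside ∷ p} {inside ∷ q}  p⊆q ∣q∣<∣p∣ =
  contradiction ∣q∣<∣p∣ (≤⇒≯ (p⊆q⇒∣p∣≤∣q∣ (drop-∷-⊆ p⊆q)))
p⊆q∧∣q∣≤∣p∣⇒p≡q {p = inside ∷ p}  {outside ∷ q} p⊆q _ with () ← p⊆q here
p⊆q∧∣q∣≤∣p∣⇒p≡q {p = inside ∷ p}  {inside ∷ q}  p⊆q ∣q∣≤∣p∣ =
  cong (inside ∷_) (p⊆q∧∣q∣≤∣p∣⇒p≡q (drop-∷-⊆ p⊆q) (s≤s⁻¹ ∣q∣≤∣p∣))

descending-chain-length : ∀ {a} {A : Set a} (μ : A → ℕ) k (q : Fin (suc k) → A) →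
  (∀ s → μ (q (fsuc s)) < μ (q (inject₁ s))) →
  k + μ (q (fromℕ k)) ≤ μ (q fzero)
descending-chain-length μ zero    q descends = ≤-refl
descending-chain-length μ (suc k) q descends =
  ≤-trans (s≤s (descending-chain-length μ k (q ∘ fsuc) (descends ∘ fsuc))) (descends fzero)

totalSize : ∀ {m n d} → (Fin m → Fin n → Subset d) → ℕ
totalSize {m} {n} G = ∑[ i < m ] ∑[ j < n ] ∣ G i j ∣

totalSize-squeeze : ∀ {m n d} {G H : Fin m → Fin n → Subset d} →
  (∀ i j → G i j ⊆ H i j) → totalSize H ≤ totalSize G → ∀ i j → G i j ≡ H i j
totalSize-squeeze {G = G} {H} G⊆H ΣH≤ΣG i j =
  p⊆q∧∣q∣≤∣p∣⇒p≡q (G⊆H i j) (≤-reflexive (sym (sizes-agree j)))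
  where
  size-≤ : ∀ i j → ∣ G i j ∣ ≤ ∣ H i j ∣
  size-≤ i j = p⊆q⇒∣p∣≤∣q∣ (G⊆H i j)
  rows-agree : ∀ i → sum (λ j → ∣ G i j ∣) ≡ sum (λ j → ∣ H i j ∣)
  rows-agree = sum-≥-squeeze (λ i → sum-mono-≤ (size-≤ i)) ΣH≤ΣG
  sizes-agree : ∀ j → ∣ G i j ∣ ≡ ∣ H i j ∣
  sizes-agree = sum-≥-squeeze (size-≤ i) (≤-reflexive (sym (rows-agree i)))

candidateCount : State → ℕ
candidateCount q = totalSize (g q)

81≤candidateCount : ∀ q → 81 ≤ candidateCount q
81≤candidateCount q = sum-mono-≤ (λ i → sum-mono-≤ (λ j → p≢⊥⇒∣p∣>0 (S1 q i j)))

candidateCount≤729 : ∀ q → candidateCount q ≤ 729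
candidateCount≤729 q = sum-mono-≤ (λ i → sum-mono-≤ (λ j → ∣p∣≤n (g q i j)))

module _ {R : State → State → Set} (T : IsStateTransition R) where
  open IsStateTransition T

  candidates-shrink : ∀ {q q'} → R q q' → ∀ i j → g q' i j ⊆ g q i j
  candidates-shrink {q} r i j {x} x∈g' =
    decidable-stable (x ∈? g q i j) (λ x∉g → keepsRemoved r i j x x∉g x∈g')

  candidateCount-decreases : ∀ {q q'} → R q q' → ¬ SameG q q' →
    candidateCount q' < candidateCount q
  candidateCount-decreases r g≢g' = ≰⇒> λ count≤count' →
    g≢g' λ i j → sym (totalSize-squeeze (candidates-shrink r) count≤count' i j)

mainTheorem3 : (R : State → State → Set) → IsStateTransition R →
    (k : ℕ) (q : Fin (suc k) → State) →
    (∀ (s : Fin k) → R (q (inject₁ s)) (q (fsuc s))) →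
    (∀ (s : Fin k) → ¬ SameG (q (inject₁ s)) (q (fsuc s))) →
    k ≤ 648
mainTheorem3 R T k q steps changes = +-cancelʳ-≤ 81 k 648 (begin
  k + 81                           ≤⟨ +-monoʳ-≤ k (81≤candidateCount (q (fromℕ k))) ⟩
  k + candidateCount (q (fromℕ k)) ≤⟨ descending-chain-length candidateCount k q descends ⟩
  candidateCount (q fzero)         ≤⟨ candidateCount≤729 (q fzero) ⟩
  729                              ∎)
  where
  open ≤-Reasoning
  descends : ∀ s → candidateCount (q (fsuc s)) < candidateCount (q (inject₁ s))
  descends s = candidateCount-decreases T (steps s) (changes s)
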